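{- Let $G$ be a finite simple connected graph and let $H$ be a $3$-induced subgraph of $G$. If $D_3(H)$ is connected and for every $x\in V(G)\setminus V(H)$ there is $y\in V(H)$ with $d_G(x,y)\geqslant 3$, then $D_3(G)$ is connected.
   Context: For a graph $G$ and vertices $x,y$, $d_G(x,y)$ is the length of a shortest path between them. The $3$-distance graph $D_3(G)$ has vertex set $V(G)$, two vertices being adjacent iff their distance in $G$ is exactly $3$. A subgraph $H$ of $G$ is called $t$-induced if for all $x,y\in V(H)$ with $d_G(x,y)\leqslant t$ one has $d_H(x,y)=d_G(x,y)$. -}

module Defs where

open import Data.Nat using (ℕ; zero; suc; _<_; _≤_)
open import Data.Fin using (Fin)
open import Data.Product using (_×_; ∃)
open import Relation.Nullary using (¬_; Dec)
open import Relation.Binary.Construct.Closure.ReflexiveTransitive using (Star)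

record SimpleGraph (n : ℕ) : Set₁ where
  field
    Adj     : Fin n → Fin n → Set
    Adj-dec : ∀ x y → Dec (Adj x y)
    sym     : ∀ {x y} → Adj x y → Adj y x
    irrefl  : ∀ {x} → ¬ Adj x x
open SimpleGraph public

record Subgraph {n : ℕ} (G : SimpleGraph n) : Set₁ where
  field
    V       : Fin n → Set
    V-dec   : ∀ x → Dec (V x)
    E       : Fin n → Fin n → Set
    E-dec   : ∀ x y → Dec (E x y)
    E-sym   : ∀ {x y} → E x y → E y x
    E⊆Adj   : ∀ {x y} → E x y → Adj G x y
    E⊆V     : ∀ {x y} → E x y → V x × V y
open Subgraph public

data Walk {n : ℕ} (R : Fin n → Fin n → Set) : Fin n → Fin n → ℕ → Set where
  nil  : ∀ {x} → Walk R x x zero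
  cons : ∀ {x y z k} → R x y → Walk R y z k → Walk R x z (suc k)

Dist : {n : ℕ} → (Fin n → Fin n → Set) → Fin n → Fin n → ℕ → Set
Dist R x y k = Walk R x y k × (∀ m → m < k → ¬ Walk R x y m)

Connected : {n : ℕ} → SimpleGraph n → Set
Connected G = ∀ x y → ∃ λ k → Walk (Adj G) x y k

distG : {n : ℕ} → SimpleGraph n → Fin n → Fin n → ℕ → Set
distG G = Dist (Adj G)

distH : {n : ℕ} {G : SimpleGraph n} → Subgraph G → Fin n → Fin n → ℕ → Set
distH H = Dist (E H)

IsTInduced : {n : ℕ} (G : SimpleGraph n) → ℕ → Subgraph G → Set
IsTInduced G t H =
  ∀ x y → V H x → V H y → ∀ k → k ≤ t → distG G x y k → distH H x y k

D3Adj : {n : ℕ} → SimpleGraph n → Fin n → Fin n → Set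
D3Adj G x y = distG G x y 3

D3AdjH : {n : ℕ} {G : SimpleGraph n} → Subgraph G → Fin n → Fin n → Set
D3AdjH H x y = V H x × V H y × distH H x y 3

D3Connected : {n : ℕ} → SimpleGraph n → Set
D3Connected G = ∀ x y → Star (D3Adj G) x y

D3ConnectedH : {n : ℕ} {G : SimpleGraph n} → Subgraph G → Set
D3ConnectedH H = ∀ x y → V H x → V H y → Star (D3AdjH H) x y

-- Every vertex x is joined in D₃(G) to some vertex of V(H); induct on h = d_G(x, V(H)).
-- If h ≥ 3, the third vertex x₃ of a shortest path from x to V(H) satisfies
-- d_G(x, x₃) = 3 and d_G(x₃, V(H)) = h − 3.  If h ∈ {1, 2}, pick y ∈ V(H) with
-- d_G(x, y) ≥ 3 and follow a walk in H from a vertex of V(H) at distance h ≤ 2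
-- to y, which exists since D₃(H) is connected: along it d_G(x, ·) changes by at
-- most 1 per step, so it passes through a vertex of V(H) at distance exactly 3.
-- As H is 3-induced, D₃(H) is a subgraph of D₃(G), and connects these vertices.
module Submission where

open import Defs
open import Data.Nat using (ℕ; zero; suc; _+_; _≤_; _<_; z≤n; s≤s; _≤?_)
open import Data.Nat.Properties
  using (≤-refl; ≤-trans; ≤⇒≯; ≤-antisym; <⇒≤; ≰⇒>; <-cmp; +-monoˡ-<; anyUpTo?)
open import Data.Nat.Induction using (<-rec)
open import Data.Fin using (Fin; _≟_)
open import Data.Fin.Properties using (any?)
open import Data.Product using (_×_; ∃; _,_; proj₁; proj₂)
open import Data.Empty using (⊥-elim)
open import Relation.Nullary using (¬_; Dec; yes; no)
open import Relation.Nullary.Decidable using (map′; _×-dec_)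
open import Relation.Unary using (Decidable)
open import Relation.Binary using (tri<; tri≈; tri>)
open import Relation.Binary.PropositionalEquality using (_≡_; refl; subst)
open import Relation.Binary.Construct.Closure.ReflexiveTransitive as Star
  using (Star; ε; _◅_; _◅◅_)

Minimal : ∀ {p} → (ℕ → Set p) → ℕ → Set p
Minimal P k = P k × (∀ m → m < k → ¬ P m)

least : ∀ {p} {P : ℕ → Set p} → Decidable P →
        ∀ {K} → P K → ∃ λ k → k ≤ K × Minimal P k
least {P = P} P? {K} = <-rec (λ K → P K → ∃ λ k → k ≤ K × Minimal P k) step K
  where
  step : ∀ K → (∀ {m} → m < K → P m → ∃ λ k → k ≤ m × Minimal P k) →
         P K → ∃ λ k → k ≤ K × Minimal P k
  step K rec pK with anyUpTo? P? K
  ... | yes (m , m<K , pm) with rec m<K pm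
  ...   | k , k≤m , min = k , ≤-trans k≤m (<⇒≤ m<K) , min
  step K rec pK | no none = K , ≤-refl , pK , λ m m<K pm → none (m , m<K , pm)

module _ {n : ℕ} {R : Fin n → Fin n → Set} where

  _++_ : ∀ {x y z j k} → Walk R x y j → Walk R y z k → Walk R x z (j + k)
  nil      ++ v = v
  cons r w ++ v = cons r (w ++ v)

  snoc : ∀ {x y z k} → Walk R x y k → R y z → Walk R x z (suc k)
  snoc nil        r = cons r nil
  snoc (cons s w) r = cons s (snoc w r)

  reverse : (∀ {x y} → R x y → R y x) → ∀ {x y k} → Walk R x y k → Walk R y x k
  reverse R-sym nil        = nil
  reverse R-sym (cons r w) = snoc (reverse R-sym w) (R-sym r)

  Dist-sym : (∀ {x y} → R x y → R y x) → ∀ {x y k} → Dist R x y k → Dist R y x k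
  Dist-sym R-sym (w , shortest) =
    reverse R-sym w , λ m m<k w′ → shortest m m<k (reverse R-sym w′)

  Dist-unique : ∀ {x y j k} → Dist R x y j → Dist R x y k → j ≡ k
  Dist-unique {j = j} {k} (v , v-shortest) (w , w-shortest) with <-cmp j k
  ... | tri< j<k _ _ = ⊥-elim (w-shortest j j<k v)
  ... | tri≈ _ j≡k _ = j≡k
  ... | tri> _ _ k<j = ⊥-elim (v-shortest k k<j w)

  module _ (R? : ∀ x y → Dec (R x y)) where

    walk? : ∀ k x y → Dec (Walk R x y k)
    walk? zero x y with x ≟ y
    ... | yes refl = yes nil
    ... | no x≢y   = no λ { nil → x≢y refl }
    walk? (suc k) x y =
      map′ (λ { (_ , r , w) → cons r w }) (λ { (cons r w) → _ , r , w })
           (any? λ z → R? x z ×-dec walk? k z y)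

    walk⇒dist : ∀ {x y K} → Walk R x y K → ∃ λ k → k ≤ K × Dist R x y k
    walk⇒dist {x} {y} = least (λ k → walk? k x y)

walk-map : ∀ {n} {R S : Fin n → Fin n → Set} → (∀ {x y} → R x y → S x y) →
           ∀ {x y k} → Walk R x y k → Walk S x y k
walk-map f nil        = nil
walk-map f (cons r w) = cons (f r) (walk-map f w)

module _ {n : ℕ} (G : SimpleGraph n) where

  -- Discrete intermediate value theorem for d_G(x₀, ·) along a walk inside G.
  dist-crossing : ∀ {R : Fin n → Fin n → Set} {P : Fin n → Set} →
                  (∀ {u v} → R u v → Adj G u v) → (∀ {u v} → R u v → P v) →
                  ∀ x₀ t {a b k} → Walk R a b k →
                  ∀ {j} → j ≤ t → distG G x₀ a j → (∀ d → distG G x₀ b d → t < d) →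
                  ∃ λ z → P z × distG G x₀ z (suc t)
  dist-crossing R⊆Adj R⇒P x₀ t nil j≤t dist-a far-b = ⊥-elim (≤⇒≯ j≤t (far-b _ dist-a))
  dist-crossing R⊆Adj R⇒P x₀ t (cons {y = a′} r w) {j} j≤t (path-a , _) far-b
    with walk⇒dist (Adj-dec G) (snoc path-a (R⊆Adj r))
  ... | d , d≤j+1 , dist-a′ with d ≤? t
  ...   | yes d≤t = dist-crossing R⊆Adj R⇒P x₀ t w d≤t dist-a′ far-b
  ...   | no d≰t  = a′ , R⇒P r , subst (distG G x₀ a′) d≡t+1 dist-a′
    where
    d≡t+1 : d ≡ suc t
    d≡t+1 = ≤-antisym (≤-trans d≤j+1 (s≤s j≤t)) (≰⇒> d≰t)

  induced-dist : ∀ {t} (H : Subgraph G) → IsTInduced G t H →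
                 ∀ {x y k} → V H x → V H y → k ≤ t → distH H x y k → distG G x y k
  induced-dist H induced {x} {y} x∈H y∈H k≤t dist-H
    with walk⇒dist (Adj-dec G) (walk-map (E⊆Adj H) (proj₁ dist-H))
  ... | d , d≤k , dist-G =
    subst (distG G x y)
          (Dist-unique (induced x y x∈H y∈H d (≤-trans d≤k k≤t) dist-G) dist-H)
          dist-G

  D3AdjH⇒D3Adj : ∀ (H : Subgraph G) → IsTInduced G 3 H → ∀ {a b} → D3AdjH H a b → D3Adj G a b
  D3AdjH⇒D3Adj H induced (a∈H , b∈H , dist-H) = induced-dist H induced a∈H b∈H ≤-refl dist-H

module _ {n : ℕ} (G : SimpleGraph n) (H : Subgraph G) where

  WalkToH : Fin n → ℕ → Set
  WalkToH x k = ∃ λ u → V H u × Walk (Adj G) x u k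

  walkToH? : ∀ x k → Dec (WalkToH x k)
  walkToH? x k = any? λ u → V-dec H u ×-dec walk? (Adj-dec G) k x u

  D3ReachesH : Fin n → Set
  D3ReachesH x = ∃ λ z → V H z × Star (D3Adj G) x z

  d3-reaches-◅ : ∀ {x y} → D3Adj G x y → D3ReachesH y → D3ReachesH x
  d3-reaches-◅ x~y (z , z∈H , y↝z) = z , z∈H , x~y ◅ y↝z

  d3H-walk : ∀ {a b} → Star (D3AdjH H) a b → ∃ λ k → Walk (E H) a b k
  d3H-walk ε = 0 , nil
  d3H-walk ((_ , _ , w , _) ◅ s) with d3H-walk s
  ... | k , w′ = 3 + k , w ++ w′

  module _ (d3H-connected : D3ConnectedH H)
           (far : ∀ x → ¬ V H x → ∃ λ y → V H y × (∀ k → distG G x y k → 3 ≤ k)) where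

    d3-reaches-near : ∀ {h x} → suc h ≤ 2 → Minimal (WalkToH x) (suc h) → D3ReachesH x
    d3-reaches-near {x = x} h<2 ((u , u∈H , path) , shortest)
      with far x (λ x∈H → shortest 0 (s≤s z≤n) (x , x∈H , nil))
         | walk⇒dist (Adj-dec G) path
    ... | y , y∈H , far-y | j , j≤h+1 , dist-xu
      with d3H-walk (d3H-connected u y u∈H y∈H)
    ... | _ , w
      with dist-crossing G (E⊆Adj H) (λ e → proj₂ (E⊆V H e))
                         x 2 w (≤-trans j≤h+1 h<2) dist-xu far-y
    ... | z , z∈H , dist-xz = z , z∈H , dist-xz ◅ ε

    d3-reaches : ∀ h {x} → Minimal (WalkToH x) h → D3ReachesH x
    d3-reaches zero ((u , u∈H , nil) , _) = u , u∈H , ε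
    d3-reaches 1 = d3-reaches-near (s≤s z≤n)
    d3-reaches 2 = d3-reaches-near (s≤s (s≤s z≤n))
    d3-reaches (suc (suc (suc h))) {x}
               ((u , u∈H , cons r₁ (cons r₂ (cons {y = x₃} r₃ rest))) , shortest) =
      d3-reaches-◅ (x→x₃ , no-shortcut) (d3-reaches h ((u , u∈H , rest) , shortest-from-x₃))
      where
      x→x₃ : Walk (Adj G) x x₃ 3
      x→x₃ = cons r₁ (cons r₂ (cons r₃ nil))

      no-shortcut : ∀ m → m < 3 → ¬ Walk (Adj G) x x₃ m
      no-shortcut m m<3 w = shortest (m + h) (+-monoˡ-< h m<3) (u , u∈H , w ++ rest)

      shortest-from-x₃ : ∀ m → m < h → ¬ WalkToH x₃ m
      shortest-from-x₃ m m<h (u′ , u′∈H , w) =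
        shortest (3 + m) (s≤s (s≤s (s≤s m<h))) (u′ , u′∈H , x→x₃ ++ w)

    d3-reaches-all : Connected G → ∀ x → D3ReachesH x
    d3-reaches-all connected x with V-dec H x
    ... | yes x∈H = x , x∈H , ε
    ... | no x∉H with far x x∉H
    ... | y , y∈H , _ with connected x y
    ... | _ , path with least (walkToH? x) (y , y∈H , path)
    ... | h , _ , minimal = d3-reaches h minimal

lemma2p2 : ∀ {n : ℕ} (G : SimpleGraph n) (H : Subgraph G)
    → Connected G
    → IsTInduced G 3 H
    → D3ConnectedH H
    → (∀ x → ¬ V H x → ∃ λ y → V H y × (∀ k → distG G x y k → 3 ≤ k))
    → D3Connected G
lemma2p2 G H connected induced d3H-connected far x y
  with d3-reaches-all G H d3H-connected far connected x
     | d3-reaches-all G H d3H-connected far connected y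
... | z₁ , z₁∈H , x↝z₁ | z₂ , z₂∈H , y↝z₂ =
  x↝z₁ ◅◅ Star.map (D3AdjH⇒D3Adj G H induced) (d3H-connected z₁ z₂ z₁∈H z₂∈H)
       ◅◅ Star.reverse (Dist-sym (sym G)) y↝z₂
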